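{- Let $P=(Q,\Sigma,q_{in},\Delta)$ be a $1$-phase-bounded protocol and $Q^b=Q_0\cup Q_1^b$. For every $(q,\Lambda)\in Q^b\times 2^{Q^b}$: we have $(q_{in},\Lambda_{in})\Rightarrow^*(q,\Lambda)$ for some $\Lambda_{in}\in\{\emptyset,\{q_{in}\}\}$ if and only if there exist two b-configurations $C_{in}$ (initial) and $C$ such that $C_{in}\to^* C$ and $\mathrm{bprint}(C)=(q,\Lambda)$.
   Context: A broadcast protocol is $P=(Q,\Sigma,q_{in},\Delta)$ with finite $Q$, finite $\Sigma$, $q_{in}\in Q$, $\Delta\subseteq Q\times(\{!!m\}\cup\{?m\}\cup\{\tau\})\times Q$ ($m\in\Sigma$; broadcast, reception, internal). $R(q)=\{m:\exists q',(q,?m,q')\in\Delta\}$. Topologies are finite undirected graphs without self-loops; configurations $(\Gamma,L)$ with $L:V(\Gamma)\to Q$, initial if all labels are $q_{in}$. $C=(\Gamma,L)\xrightarrow{v,\delta}C'=(\Gamma,L')$ for $\delta=(q,\alpha,q')$ if $L(v)=q$, $L'(v)=q'$ and either $\alpha=\tau$ and other labels unchanged, or $\alpha=!!m$, every neighbour $u$ of $v$ satisfies $(L(u),?m,L'(u))\in\Delta$ or ($m\notin R(L(u))$ and $L'(u)=L(u)$), and non-neighbours other than $v$ are unchanged; $\to$ is the union of these steps and $\to^*$ its reflexive transitive closure. $P$ is $1$-phase-bounded if $Q$ can be partitioned into $Q_0,Q_1^b,Q_1^r$ with $q_{in}\in Q_0$ such that every $(q,\alpha,q')\in\Delta$ satisfies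 one of: $\alpha=\tau$ and $q,q'$ in the same part; $q,q'\in Q_1^b$, $\alpha$ a broadcast; $q,q'\in Q_1^r$, $\alpha$ a reception; $q\in Q_0,q'\in Q_1^r$, $\alpha$ a reception; $q\in Q_0,q'\in Q_1^b$, $\alpha$ a broadcast; $q\in Q_1^b,q'\in Q_1^r$, $\alpha$ a reception. A star topology has vertex set $\{\epsilon\}\cup\{1,\dots,n\}$ ($n\ge0$) with edges exactly between $\epsilon$ and each other vertex; a star-configuration is a configuration on a star topology. A b-configuration is a star-configuration $C=(\Gamma,L)$ with $L(\epsilon)\in Q^b$; $\mathrm{bprint}(C)=(L(\epsilon),\{L(v)\in Q^b:v\in V(\Gamma)\setminus\{\epsilon\}\})$. $(q,\Lambda)\Rightarrow(q',\Lambda')$ iff there exist b-configurations $C,C'$ with $\mathrm{bprint}(C)=(q,\Lambda)$, $\mathrm{bprint}(C')=(q',\Lambda')$ and $C\to C'$; $\Rightarrow^*$ is its reflexive transitive closure. -}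

module Defs where

open import Data.Nat using (ℕ; suc)
open import Data.Fin using (Fin; zero; suc)
open import Data.Fin.Subset using (Subset; _∈_; ⊥; ⁅_⁆)
open import Data.Product using (Σ; ∃; ∃-syntax; _×_; _,_)
open import Data.Sum using (_⊎_)
open import Data.Unit using (⊤)
open import Data.Empty renaming (⊥ to Empty)
open import Relation.Nullary using (¬_)
open import Relation.Binary.PropositionalEquality using (_≡_; _≢_)
open import Relation.Binary.Construct.Closure.ReflexiveTransitive using (Star)
open import Function.Bundles using (_⇔_)

data Act (nΣ : ℕ) : Set where
  bc  : Fin nΣ → Act nΣ
  rc  : Fin nΣ → Act nΣ
  τ   : Act nΣ

record Protocol : Set₁ where
  field
    nQ  : ℕ
    nΣ  : ℕ
    qin : Fin nQ
    Δ   : Fin nQ → Act nΣ → Fin nQ → Set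

record Graph : Set₁ where
  field
    size    : ℕ
    adj     : Fin size → Fin size → Set
    adj-sym : ∀ {u v} → adj u v → adj v u
    irrefl  : ∀ {v} → ¬ adj v v

-- Star topology on {ε} ∪ {1..n}, with ε = zero and i = suc (i-1)
starAdj : ∀ {n} → Fin (suc n) → Fin (suc n) → Set
starAdj zero    zero    = Empty
starAdj zero    (suc _) = ⊤
starAdj (suc _) zero    = ⊤
starAdj (suc _) (suc _) = Empty

starAdj-sym : ∀ {n} {u v : Fin (suc n)} → starAdj u v → starAdj v u
starAdj-sym {u = zero}  {v = suc _} p = p
starAdj-sym {u = suc _} {v = zero}  p = p

starAdj-irrefl : ∀ {n} {v : Fin (suc n)} → ¬ starAdj v v
starAdj-irrefl {v = zero}  ()
starAdj-irrefl {v = suc _} ()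

star : ℕ → Graph
star n = record
  { size = suc n ; adj = starAdj ; adj-sym = starAdj-sym ; irrefl = starAdj-irrefl }

-- 1-phase-boundedness: partition Q = Q0 ⊎ Q1b ⊎ Q1r given by a map Q → Part

data Part : Set where
  p0 p1b p1r : Part

data Allowed {nΣ : ℕ} : Part → Act nΣ → Part → Set where
  int-same : ∀ {p}  → Allowed p τ p
  b-bb     : ∀ {m}  → Allowed p1b (bc m) p1b
  r-rr     : ∀ {m}  → Allowed p1r (rc m) p1r
  r-0r     : ∀ {m}  → Allowed p0  (rc m) p1r
  b-0b     : ∀ {m}  → Allowed p0  (bc m) p1b
  r-br     : ∀ {m}  → Allowed p1b (rc m) p1r

module _ (P : Protocol) where
  open Protocol P

  IsPhasePartition : (Fin nQ → Part) → Set
  IsPhasePartition part =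
    (part qin ≡ p0) × (∀ q α q' → Δ q α q' → Allowed (part q) α (part q'))

  OnePhaseBounded : Set
  OnePhaseBounded = Σ (Fin nQ → Part) IsPhasePartition

  InR : Fin nQ → Fin nΣ → Set
  InR q m = ∃[ q' ] Δ q (rc m) q'

  Config : Set₁
  Config = Σ Graph (λ Γ → Fin (Graph.size Γ) → Fin nQ)

  Initial : Config → Set
  Initial (Γ , L) = ∀ v → L v ≡ qin

  data StepOn (Γ : Graph) (L L' : Fin (Graph.size Γ) → Fin nQ) : Set where
    internal : (v : Fin (Graph.size Γ)) (q q' : Fin nQ) →
      Δ q τ q' → L v ≡ q → L' v ≡ q' →
      (∀ u → u ≢ v → L' u ≡ L u) → StepOn Γ L L'
    broadcast : (v : Fin (Graph.size Γ)) (q q' : Fin nQ) (m : Fin nΣ) →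
      Δ q (bc m) q' → L v ≡ q → L' v ≡ q' →
      (∀ u → Graph.adj Γ v u →
         Δ (L u) (rc m) (L' u) ⊎ ((¬ InR (L u) m) × (L' u ≡ L u))) →
      (∀ u → u ≢ v → ¬ Graph.adj Γ v u → L' u ≡ L u) →
      StepOn Γ L L'

  data _⟶_ : Config → Config → Set₁ where
    step : ∀ {Γ L L'} → StepOn Γ L L' → (Γ , L) ⟶ (Γ , L')

  _⟶*_ : Config → Config → Set₁
  _⟶*_ = Star _⟶_

  module _ (part : Fin nQ → Part) where

    InQb : Fin nQ → Set
    InQb q = (part q ≡ p0) ⊎ (part q ≡ p1b)

    record BConfig : Set where
      field
        arms  : ℕ
        label : Fin (suc arms) → Fin nQ
        centreB : InQb (label zero)

    toConfig : BConfig → Config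
    toConfig C = star (BConfig.arms C) , BConfig.label C

    BPrint : Set
    BPrint = Fin nQ × Subset nQ

    HasBPrint : BConfig → BPrint → Set
    HasBPrint C (q , Λ) =
      (BConfig.label C zero ≡ q) ×
      (∀ s → (s ∈ Λ) ⇔ (InQb s × ∃[ w ] BConfig.label C (suc w) ≡ s))

    _⇒_ : BPrint → BPrint → Set₁
    x ⇒ y = ∃[ C ] ∃[ C' ]
      (HasBPrint C x × HasBPrint C' y × (toConfig C ⟶ toConfig C'))

    _⇒*_ : BPrint → BPrint → Set₁
    _⇒*_ = Star _⇒_

{-# OPTIONS --safe #-}

-- In a 1-phase-bounded protocol Q^b is closed backwards under steps: receptions lead
-- into Q1r, internal steps stay in their part, and only Q^b states broadcast.  So every
-- configuration on a run ending in a b-configuration is a b-configuration, and the run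
-- projects to a ⇒-path of b-prints.
--
-- Conversely, a b-print forgets how often a state occurs at the leaves.  A step of a star
-- can be replayed on any star whose leaves are copies of some of its leaves: a step of the
-- centre acts on all copies at once, and a step of a leaf is repeated by each of its copies,
-- which is harmless because the centre, staying in Q^b, ignores the broadcast.  Tracing one
-- leaf per state of the final Λ backwards along a ⇒-path gives leaves that all start in
-- q_in, hence a run from an initial configuration.

module Submission where

open import Defs
open import Data.Nat using (ℕ; suc)
open import Data.Fin using (Fin; zero; suc; _≟_)
open import Data.Fin.Properties using (any?; suc-injective)
open import Data.Fin.Subset using (Subset; _∈_; ⊥; ⁅_⁆)
open import Data.Fin.Subset.Properties using (_∈?_; ∉⊥; x∈⁅x⁆; x∈⁅y⁆⇒x≡y; ⊆-antisym)
open import Data.Vec using (tabulate)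
open import Data.Vec.Properties using ([]=⇒lookup; lookup⇒[]=; lookup∘tabulate)
open import Data.Vec.Functional using (Vector; _∷_; head; tail; updateAt)
open import Data.Vec.Functional.Properties using (∷-cong; updateAt-updates; updateAt-minimal; updateAt-id-local)
open import Data.List as List using (List; allFin; filter; lookup)
open import Data.List.Membership.Propositional using () renaming (_∉_ to _∉ˡ_)
open import Data.List.Membership.Propositional.Properties using (∈-allFin; ∈-filter⁺; ∈-filter⁻; ∈-lookup)
open import Data.List.Relation.Unary.Any using (here; there; index)
open import Data.List.Relation.Unary.Any.Properties using (lookup-index)
open import Data.Product using (Σ; ∃-syntax; _×_; _,_; proj₁; proj₂)
open import Data.Sum using (_⊎_; inj₁; inj₂)
open import Data.Bool using (true)
open import Data.Unit using (tt)
open import Function using (_∘_; const; case_of_)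
open import Function.Bundles using (_⇔_; mk⇔; Equivalence)
open import Relation.Nullary using (¬_; Dec; yes; no; does; contradiction)
open import Relation.Nullary.Decidable using (_×-dec_; dec-true; decidable-stable; ¬¬-excluded-middle)
open import Relation.Unary using (Pred; Decidable)
open import Relation.Binary.PropositionalEquality using (_≡_; _≢_; _≗_; refl; sym; trans; cong; subst; subst₂)
open import Relation.Binary.Construct.Closure.ReflexiveTransitive using (ε; _◅_; _◅◅_)

subsetOf : ∀ {n ℓ} {A : Pred (Fin n) ℓ} → Decidable A → Subset n
subsetOf A? = tabulate (does ∘ A?)

∈-subsetOf : ∀ {n ℓ} {A : Pred (Fin n) ℓ} (A? : Decidable A) {x} → x ∈ subsetOf A? ⇔ A x
∈-subsetOf A? {x} = mk⇔
  (λ x∈ → witness (A? x) (trans (sym (lookup∘tabulate _ x)) ([]=⇒lookup x∈)))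
  (λ a → lookup⇒[]= x _ (trans (lookup∘tabulate _ x) (dec-true (A? x) a)))
  where
  witness : ∀ {B : Set _} (b? : Dec B) → does b? ≡ true → B
  witness (yes b) _ = b

enumerate : ∀ {k} (Λ : Subset k) →
            ∃[ n ] Σ (Vector (Fin k) n) λ f → ∀ s → s ∈ Λ ⇔ (∃[ j ] f j ≡ s)
enumerate {k} Λ = List.length members , lookup members , λ s → mk⇔
  (λ s∈Λ → let s∈members = ∈-filter⁺ (_∈? Λ) (∈-allFin s) s∈Λ
           in index s∈members , sym (lookup-index s∈members))
  (λ { (j , refl) → proj₂ (∈-filter⁻ (_∈? Λ) {xs = allFin k} (∈-lookup j)) })
  where
  members : List (Fin k)
  members = filter (_∈? Λ) (allFin k)

∷-updateAt-minimal : ∀ {a} {A : Set a} {n} {x : A} {g : Vector A n} j {f : A → A} u →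
                     u ≢ suc j → (x ∷ updateAt g j f) u ≡ (x ∷ g) u
∷-updateAt-minimal j zero    _   = refl
∷-updateAt-minimal j (suc i) i≢j = updateAt-minimal i j _ (i≢j ∘ cong suc)

IsB : Part → Set
IsB p = (p ≡ p0) ⊎ (p ≡ p1b)

¬IsB-p1r : ¬ IsB p1r
¬IsB-p1r (inj₁ ())
¬IsB-p1r (inj₂ ())

IsB? : ∀ p → Dec (IsB p)
IsB? p0  = yes (inj₁ refl)
IsB? p1b = yes (inj₂ refl)
IsB? p1r = no ¬IsB-p1r

module _ {nΣ : ℕ} {p p' : Part} where

  Allowed-rc-¬IsB : ∀ {m : Fin nΣ} → Allowed p (rc m) p' → ¬ IsB p'
  Allowed-rc-¬IsB r-rr = ¬IsB-p1r
  Allowed-rc-¬IsB r-0r = ¬IsB-p1r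
  Allowed-rc-¬IsB r-br = ¬IsB-p1r

  Allowed-bc-IsB : ∀ {m : Fin nΣ} → Allowed p (bc m) p' → IsB p
  Allowed-bc-IsB b-bb = inj₂ refl
  Allowed-bc-IsB b-0b = inj₁ refl

  Allowed-τ-≡ : Allowed {nΣ} p τ p' → p ≡ p'
  Allowed-τ-≡ int-same = refl

module StarRuns (P : Protocol) where
  open Protocol P

  Labelling : ℕ → Set
  Labelling n = Vector (Fin nQ) (suc n)

  StepOn-respˡ : ∀ {Γ} {L₁ L₂ L' : Fin (Graph.size Γ) → Fin nQ} →
                 L₁ ≗ L₂ → StepOn P Γ L₁ L' → StepOn P Γ L₂ L'
  StepOn-respˡ L₁≗L₂ (internal v _ q' d refl L'v rest) =
    internal v _ q' d (sym (L₁≗L₂ v)) L'v λ u u≢v → trans (rest u u≢v) (L₁≗L₂ u)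
  StepOn-respˡ {L' = L'} L₁≗L₂ (broadcast v _ q' m d refl L'v receivers rest) =
    broadcast v _ q' m d (sym (L₁≗L₂ v)) L'v
      (λ u adj → subst (λ s → Δ s (rc m) (L' u) ⊎ (¬ InR P s m × L' u ≡ s))
                       (L₁≗L₂ u) (receivers u adj))
      (λ u u≢v ¬adj → trans (rest u u≢v ¬adj) (L₁≗L₂ u))

  -- Without function extensionality the end labelling of a run is only determined
  -- pointwise, so reachability is taken up to _≗_.
  _↝_ : ∀ {n} → Labelling n → Labelling n → Set₁
  _↝_ {n} L L' = ∃[ M ] _⟶*_ P (star n , L) (star n , M) × M ≗ L'

  ↝-refl : ∀ {n} {L : Labelling n} → L ↝ L
  ↝-refl {L = L} = L , ε , λ _ → refl

  StepOn⇒↝ : ∀ {n} {L L' : Labelling n} → StepOn P (star n) L L' → L ↝ L'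
  StepOn⇒↝ {L' = L'} s = L' , step s ◅ ε , λ _ → refl

  ↝-respˡ : ∀ {n} {L₁ L₂ L' : Labelling n} → L₁ ≗ L₂ → L₁ ↝ L' → L₂ ↝ L'
  ↝-respˡ {L₂ = L₂} L₁≗L₂ (_ , ε , M≗) = L₂ , ε , λ v → trans (sym (L₁≗L₂ v)) (M≗ v)
  ↝-respˡ L₁≗L₂ (M , step s ◅ run , M≗) = M , step (StepOn-respˡ L₁≗L₂ s) ◅ run , M≗

  ↝-respʳ : ∀ {n} {L L₁ L₂ : Labelling n} → L ↝ L₁ → L₁ ≗ L₂ → L ↝ L₂
  ↝-respʳ (M , run , M≗) L₁≗L₂ = M , run , λ v → trans (M≗ v) (L₁≗L₂ v)

  ↝-trans : ∀ {n} {L M N : Labelling n} → L ↝ M → M ↝ N → L ↝ N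
  ↝-trans (M' , run , M'≗M) M↝N with ↝-respˡ (sym ∘ M'≗M) M↝N
  ... | N' , run' , N'≗N = N' , run ◅◅ run' , N'≗N

  data SoloMove (c s s' : Fin nQ) : Set where
    solo-τ  : Δ s τ s' → SoloMove c s s'
    solo-bc : ∀ m → Δ s (bc m) s' → ¬ InR P c m → SoloMove c s s'

  SoloMove⇒StepOn : ∀ {n c} {g : Vector (Fin nQ) n} j {s'} → SoloMove c (g j) s' →
                    StepOn P (star n) (c ∷ g) (c ∷ updateAt g j (const s'))
  SoloMove⇒StepOn {g = g} j (solo-τ d) =
    internal (suc j) _ _ d refl (updateAt-updates j g) (∷-updateAt-minimal j)
  SoloMove⇒StepOn {g = g} j (solo-bc m d ¬r) =
    broadcast (suc j) _ _ m d refl (updateAt-updates j g) neighbours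
      (λ u u≢j _ → ∷-updateAt-minimal j u u≢j)
    where
    neighbours : ∀ u → starAdj (suc j) u → _
    neighbours zero _ = inj₂ (¬r , refl)

  SoloMoves : ∀ {n} → Fin nQ → Vector (Fin nQ) n → Vector (Fin nQ) n → Set
  SoloMoves c g g' = ∀ j → g j ≡ g' j ⊎ SoloMove c (g j) (g' j)

  SoloMoves⇒↝ : ∀ {n c} {g g' : Vector (Fin nQ) n} → SoloMoves c g g' → (c ∷ g) ↝ (c ∷ g')
  SoloMoves⇒↝ {n} {c} {g' = g'} = go (allFin n) λ j j∉ → contradiction (∈-allFin j) j∉
    where
    go : ∀ pending {h} → (∀ j → j ∉ˡ pending → h j ≡ g' j) → SoloMoves c h g' → (c ∷ h) ↝ (c ∷ g')
    go List.[]               settled _ = ↝-respʳ ↝-refl (∷-cong refl λ j → settled j λ ())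
    go (k List.∷ pending) {h} settled moves =
      ↝-trans move-k (go pending settled′ moves′)
      where
      h′ : Vector (Fin nQ) n
      h′ = updateAt h k (const (g' k))

      move-k : (c ∷ h) ↝ (c ∷ h′)
      move-k with moves k
      ... | inj₁ hk≡g'k =
        ↝-respʳ ↝-refl (∷-cong refl λ j → sym (updateAt-id-local k h (sym hk≡g'k) j))
      ... | inj₂ move   = StepOn⇒↝ (SoloMove⇒StepOn k move)

      settled′ : ∀ j → j ∉ˡ pending → h′ j ≡ g' j
      settled′ j j∉ with j ≟ k
      ... | yes refl = updateAt-updates k h
      ... | no j≢k   = trans (updateAt-minimal j k h j≢k)
                             (settled j λ { (here j≡k) → j≢k j≡k ; (there j∈) → j∉ j∈ })

      moves′ : SoloMoves c h′ g'
      moves′ j with j ≟ k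
      ... | yes refl = inj₁ (updateAt-updates k h)
      ... | no j≢k   = subst (λ s → s ≡ g' j ⊎ SoloMove c s (g' j))
                             (sym (updateAt-minimal j k h j≢k)) (moves j)

  reindex : ∀ {a n} → Labelling a → (Fin n → Fin a) → Labelling n
  reindex L w = head L ∷ (tail L ∘ w)

  leafMove-reindex : ∀ {a n} {L L' : Labelling a} k →
                     SoloMove (head L) (L (suc k)) (L' (suc k)) → head L' ≡ head L →
                     (∀ j → j ≢ k → L' (suc j) ≡ L (suc j)) →
                     (w : Fin n → Fin a) → reindex L w ↝ reindex L' w
  leafMove-reindex {L = L} {L'} k move centre others w =
    ↝-respʳ (SoloMoves⇒↝ moves) (∷-cong (sym centre) λ _ → refl)
    where
    moves : SoloMoves (head L) (tail L ∘ w) (tail L' ∘ w)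
    moves j with w j ≟ k
    ... | yes refl = inj₂ move
    ... | no wj≢k  = inj₁ (sym (others (w j) wj≢k))

module OnePhase (P : Protocol) (part : Fin (Protocol.nQ P) → Part)
                (phase : IsPhasePartition P part) where
  open Protocol P
  open StarRuns P

  Qb : Fin nQ → Set
  Qb = InQb P part

  Qb? : Decidable Qb
  Qb? s = IsB? (part s)

  allowed : ∀ {s α s'} → Δ s α s' → Allowed (part s) α (part s')
  allowed = proj₂ phase _ _ _

  rc-¬Qb : ∀ {s s' m} → Δ s (rc m) s' → ¬ Qb s'
  rc-¬Qb = Allowed-rc-¬IsB ∘ allowed

  bc-Qb : ∀ {s s' m} → Δ s (bc m) s' → Qb s
  bc-Qb = Allowed-bc-IsB ∘ allowed

  τ-reflects-Qb : ∀ {s s'} → Δ s τ s' → Qb s' → Qb s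
  τ-reflects-Qb d = subst IsB (sym (Allowed-τ-≡ (allowed d)))

  StepOn-reflects-Qb : ∀ {Γ} {L L' : Fin (Graph.size Γ) → Fin nQ} →
                       StepOn P Γ L L' → ∀ u → Qb (L' u) → Qb (L u)
  StepOn-reflects-Qb (internal v _ _ d refl refl rest) u b with u ≟ v
  ... | yes refl = τ-reflects-Qb d b
  ... | no u≢v   = subst Qb (rest u u≢v) b
  StepOn-reflects-Qb {L = L} (broadcast v _ _ m d refl refl receivers rest) u b with u ≟ v
  ... | yes refl = bc-Qb d
  -- Adjacency in an arbitrary graph need not be decidable, but Qb is, so the case split
  -- on adjacency is made under a double negation.
  ... | no u≢v   = decidable-stable (Qb? (L u)) λ ¬b → ¬¬-excluded-middle λ where
    (yes adj) → case receivers u adj of λ where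
      (inj₁ received)    → rc-¬Qb received b
      (inj₂ (_ , L'u≡))  → ¬b (subst Qb L'u≡ b)
    (no ¬adj) → ¬b (subst Qb (rest u u≢v ¬adj) b)

  ⟶*-reflects-Qb : ∀ {a b} {L : Labelling a} {L' : Labelling b} →
                   _⟶*_ P (star a , L) (star b , L') → Qb (head L') → Qb (head L)
  ⟶*-reflects-Qb ε              b = b
  ⟶*-reflects-Qb (step s ◅ run) b = StepOn-reflects-Qb s zero (⟶*-reflects-Qb run b)

  StepOn-reindex : ∀ {a n} {L L' : Labelling a} → StepOn P (star a) L L' → Qb (head L') →
                   (w : Fin n → Fin a) → reindex L w ↝ reindex L' w
  StepOn-reindex (internal zero _ _ d refl refl rest) _ w =
    StepOn⇒↝ (internal zero _ _ d refl refl λ where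
      zero    0≢0 → contradiction refl 0≢0
      (suc j) _   → rest (suc (w j)) λ ())
  StepOn-reindex {L = L} {L'} (internal (suc k) _ _ d refl refl rest) _ =
    leafMove-reindex {L = L} {L'} k (solo-τ d) (rest zero λ ())
      λ j j≢k → rest (suc j) (j≢k ∘ suc-injective)
  StepOn-reindex (broadcast zero _ _ m d refl refl receivers rest) _ w =
    StepOn⇒↝ (broadcast zero _ _ m d refl refl
      (λ { (suc j) _ → receivers (suc (w j)) tt })
      (λ { zero 0≢0 _ → contradiction refl 0≢0 ; (suc j) _ ¬adj → contradiction tt ¬adj }))
  StepOn-reindex {L = L} {L'} (broadcast (suc k) _ _ m d refl refl receivers rest) b
    with receivers zero tt
  ... | inj₁ received           = contradiction b (rc-¬Qb received)
  ... | inj₂ (¬receives , L'₀≡) =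
    leafMove-reindex {L = L} {L'} k (solo-bc m d ¬receives) L'₀≡
      λ j j≢k → rest (suc j) (j≢k ∘ suc-injective) λ ()

  IsBLeaf : ∀ {a} → Labelling a → Fin nQ → Set
  IsBLeaf L s = Qb s × ∃[ w ] L (suc w) ≡ s

  IsBLeaf? : ∀ {a} (L : Labelling a) → Decidable (IsBLeaf L)
  IsBLeaf? L s = Qb? s ×-dec any? λ w → L (suc w) ≟ s

  BLeaves : ∀ {a} → Labelling a → Subset nQ → Set
  BLeaves L Λ = ∀ s → s ∈ Λ ⇔ IsBLeaf L s

  bleaves : ∀ {a} → Labelling a → Subset nQ
  bleaves L = subsetOf (IsBLeaf? L)

  bleaves-BLeaves : ∀ {a} (L : Labelling a) → BLeaves L (bleaves L)
  bleaves-BLeaves L s = ∈-subsetOf (IsBLeaf? L)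

  BLeaves-unique : ∀ {a} {L : Labelling a} {Λ Λ'} → BLeaves L Λ → BLeaves L Λ' → Λ ≡ Λ'
  BLeaves-unique Λ-spec Λ'-spec = ⊆-antisym
    (λ {s} s∈Λ  → Equivalence.from (Λ'-spec s) (Equivalence.to (Λ-spec s) s∈Λ))
    (λ {s} s∈Λ' → Equivalence.from (Λ-spec s) (Equivalence.to (Λ'-spec s) s∈Λ'))

  BLeaves-resp : ∀ {a} {L L' : Labelling a} {Λ} → L ≗ L' → BLeaves L Λ → BLeaves L' Λ
  BLeaves-resp L≗L' Λ-spec s = mk⇔
    (λ s∈Λ → let (b , w , Lw≡s) = Equivalence.to (Λ-spec s) s∈Λ
             in b , w , trans (sym (L≗L' (suc w))) Lw≡s)
    (λ (b , w , L'w≡s) → Equivalence.from (Λ-spec s) (b , w , trans (L≗L' (suc w)) L'w≡s))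

  StepOn⇒⇒ : ∀ {a} {L L' : Labelling a} {Λ Λ'} → StepOn P (star a) L L' →
             BLeaves L Λ → BLeaves L' Λ' → Qb (head L') → _⇒_ P part (head L , Λ) (head L' , Λ')
  StepOn⇒⇒ {a} {L} {L'} s Λ-spec Λ'-spec b =
      record { arms = a ; label = L  ; centreB = StepOn-reflects-Qb s zero b }
    , record { arms = a ; label = L' ; centreB = b }
    , (refl , Λ-spec) , (refl , Λ'-spec) , step s

  ⟶*⇒⇒* : ∀ {a b} {L : Labelling a} {L' : Labelling b} {Λ Λ'} →
          _⟶*_ P (star a , L) (star b , L') → BLeaves L Λ → BLeaves L' Λ' → Qb (head L') →
          _⇒*_ P part (head L , Λ) (head L' , Λ')
  ⟶*⇒⇒* {L = L} ε Λ-spec Λ'-spec _ with refl ← BLeaves-unique {L = L} Λ-spec Λ'-spec = ε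
  ⟶*⇒⇒* (step {L' = M} s ◅ run) Λ-spec Λ'-spec b =
    StepOn⇒⇒ s Λ-spec (bleaves-BLeaves M) M₀∈Qb ◅ ⟶*⇒⇒* run (bleaves-BLeaves M) Λ'-spec b
    where
    M₀∈Qb : Qb (head M)
    M₀∈Qb = ⟶*-reflects-Qb run b

  InitialBLeaves : Subset nQ → Set
  InitialBLeaves Λ = (Λ ≡ ⊥) ⊎ (Λ ≡ ⁅ qin ⁆)

  initial-BLeaves : ∀ {a} {L : Labelling a} → (∀ v → L v ≡ qin) →
                    ∃[ Λ ] InitialBLeaves Λ × BLeaves L Λ
  initial-BLeaves {0}     _       = ⊥ , inj₁ refl , λ s → mk⇔ (λ s∈⊥ → contradiction s∈⊥ ∉⊥) λ ()
  initial-BLeaves {suc _} initial = ⁅ qin ⁆ , inj₂ refl , λ s → mk⇔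
    (λ s∈ → case x∈⁅y⁆⇒x≡y qin s∈ of λ { refl → inj₁ (proj₁ phase) , zero , initial (suc zero) })
    (λ (_ , w , Lw≡s) → subst (_∈ ⁅ qin ⁆) (trans (sym (initial (suc w))) Lw≡s) (x∈⁅x⁆ qin))

  InitialBLeaves-⊆ : ∀ {Λ s} → InitialBLeaves Λ → s ∈ Λ → s ≡ qin
  InitialBLeaves-⊆ (inj₁ refl) s∈⊥ = contradiction s∈⊥ ∉⊥
  InitialBLeaves-⊆ (inj₂ refl) s∈  = x∈⁅y⁆⇒x≡y qin s∈

  Simulates : BPrint P part → BPrint P part → Set₁
  Simulates (q , Λ) (q' , Λ') = ∀ {n} (f : Vector (Fin nQ) n) → (∀ j → f j ∈ Λ') →
                                ∃[ g ] (∀ j → g j ∈ Λ) × (q ∷ g) ↝ (q' ∷ f)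

  Simulates-refl : ∀ {x} → Simulates x x
  Simulates-refl f f∈ = f , f∈ , ↝-refl

  Simulates-trans : ∀ {x y z} → Simulates x y → Simulates y z → Simulates x z
  Simulates-trans x≼y y≼z f f∈ with y≼z f f∈
  ... | g , g∈ , g↝f with x≼y g g∈
  ...   | h , h∈ , h↝g = h , h∈ , ↝-trans h↝g g↝f

  ⇒-simulates : ∀ {x y} → _⇒_ P part x y → Simulates x y
  ⇒-simulates {x} ( record { arms = a ; label = L }
              , record { label = L' ; centreB = L'₀∈Qb }
              , (L₀≡ , Λ-spec) , (L'₀≡ , Λ'-spec) , step s ) {n} f f∈Λ' =
    tail L ∘ w , g∈Λ ,
    ↝-respˡ (∷-cong L₀≡ λ _ → refl) (↝-respʳ (StepOn-reindex s L'₀∈Qb w) (∷-cong L'₀≡ L'w≡f))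
    where
    source : ∀ j → Qb (f j) × ∃[ v ] L' (suc v) ≡ f j
    source j = Equivalence.to (Λ'-spec (f j)) (f∈Λ' j)
    w : Fin n → Fin a
    w j = proj₁ (proj₂ (source j))
    L'w≡f : ∀ j → L' (suc (w j)) ≡ f j
    L'w≡f j = proj₂ (proj₂ (source j))
    g∈Λ : ∀ j → L (suc (w j)) ∈ proj₂ x
    g∈Λ j = Equivalence.from (Λ-spec _)
      (StepOn-reflects-Qb s (suc (w j)) (subst Qb (sym (L'w≡f j)) (proj₁ (source j))) , w j , refl)

  ⇒*-simulates : ∀ {x y} → _⇒*_ P part x y → Simulates x y
  ⇒*-simulates ε              = Simulates-refl
  ⇒*-simulates (bstep ◅ path) = Simulates-trans (⇒-simulates bstep) (⇒*-simulates path)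

  RunReachable : BPrint P part → Set₁
  RunReachable x = ∃[ Cin ] ∃[ C ] (Initial P (toConfig P part Cin) ×
                                    _⟶*_ P (toConfig P part Cin) (toConfig P part C) ×
                                    HasBPrint P part C x)

  BPrintReachable : BPrint P part → Set₁
  BPrintReachable y = ∃[ Λin ] InitialBLeaves Λin × _⇒*_ P part (qin , Λin) y

  BPrintReachable⇒RunReachable : ∀ {q Λ} → Qb q → (∀ s → s ∈ Λ → Qb s) →
                                 BPrintReachable (q , Λ) → RunReachable (q , Λ)
  BPrintReachable⇒RunReachable {q} {Λ} q∈Qb Λ⊆Qb (Λin , initialΛin , path) with enumerate Λ
  ... | n , f , Λ-image with ⇒*-simulates path f (λ j → Equivalence.from (Λ-image (f j)) (j , refl))
  ... | g , g∈Λin , qin∷g↝q∷f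
      with ↝-respˡ (∷-cong refl λ j → InitialBLeaves-⊆ initialΛin (g∈Λin j)) qin∷g↝q∷f
  ... | L , run , L≗q∷f =
      record { arms = n ; label = const qin ; centreB = inj₁ (proj₁ phase) }
    , record { arms = n ; label = L ; centreB = subst Qb (sym (L≗q∷f zero)) q∈Qb }
    , (λ _ → refl) , run , L≗q∷f zero , BLeaves-resp (sym ∘ L≗q∷f) q∷f-BLeaves
    where
    q∷f-BLeaves : BLeaves (q ∷ f) Λ
    q∷f-BLeaves s = mk⇔ (λ s∈Λ → Λ⊆Qb s s∈Λ , Equivalence.to (Λ-image s) s∈Λ)
                        (Equivalence.from (Λ-image s) ∘ proj₂)

  RunReachable⇒BPrintReachable : ∀ {x} → RunReachable x → BPrintReachable x
  RunReachable⇒BPrintReachable (Cin , C , initial , run , C₀≡q , Λ-spec)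
    with initial-BLeaves initial
  ... | Λin , initialΛin , Λin-spec =
    Λin , initialΛin ,
    subst₂ (λ p p' → _⇒*_ P part (p , Λin) (p' , _)) (initial zero) C₀≡q
           (⟶*⇒⇒* run Λin-spec Λ-spec (BConfig.centreB C))

mainTheorem11 : (P : Protocol) (part : Fin (Protocol.nQ P) → Part) →
  IsPhasePartition P part →
  (q : Fin (Protocol.nQ P)) (Λ : Subset (Protocol.nQ P)) →
  InQb P part q → (∀ s → s ∈ Λ → InQb P part s) →
  (∃[ Λin ] (((Λin ≡ ⊥) ⊎ (Λin ≡ ⁅ Protocol.qin P ⁆)) ×
             _⇒*_ P part (Protocol.qin P , Λin) (q , Λ)))
  ⇔
  (∃[ Cin ] ∃[ C ] (Initial P (toConfig P part Cin) ×
                    _⟶*_ P (toConfig P part Cin) (toConfig P part C) ×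
                    HasBPrint P part C (q , Λ)))
mainTheorem11 P part phase q Λ q∈Qb Λ⊆Qb =
  mk⇔ (BPrintReachable⇒RunReachable q∈Qb Λ⊆Qb) RunReachable⇒BPrintReachable
  where open OnePhase P part phase
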